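{- For all integers $r\geq 2$, $d\geq 1$ and $s\geq (r-1)(d+1)+2$, there exists $a_0$ such that for all integers $a\geq a_0$, \[\Sigma_{r,d}(a,s+1)-\Sigma_{r,d}(a,s)-1< \left(a +\frac{r-2+x_{r\star}(a,d)}{r-1}\right)s.\]
   Context: A multigraph is a pair $G=(V,w)$ where $V$ is a finite set and $w:\binom{V}{2}\to\mathbb{Z}_{\geq 0}$; $e(G)=\sum_{xy\in\binom{V}{2}}w(xy)$. For positive integers $a,r$, $d\in\{0,\dots,a-1\}$ and $n$, $\mathcal{T}_{r,d}(a,n)$ is the set of multigraphs $G$ on $[n]=\{1,\dots,n\}$ whose vertex set can be partitioned into $r$ parts $V_0,\dots,V_{r-1}$ such that all pairs inside $V_0$ have multiplicity $a-d$, all pairs inside $V_i$ ($1\le i\le r-1$) have multiplicity $a$, and all other pairs have multiplicity $a+1$. $\Sigma_{r,d}(a,n)=\max\{e(G):G\in\mathcal{T}_{r,d}(a,n)\}$. For integers $a>d\ge0$, $x_{r\star}(a,d)=\log\left(\frac{a+1}{a}\right)\Big/\log\left(\frac{(a+1)^r}{a(a-d)^{r-1}}\right)$. -}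

module Defs where

open import Data.Nat as ℕ using (ℕ; zero; suc; _∸_; _^_; _*_)
open import Data.Fin using (Fin; zero; suc; _≟_)
open import Data.Integer as ℤ using (ℤ; +_)
open import Data.Product using (Σ; ∃; _×_)
open import Data.Sum using (_⊎_)
open import Relation.Nullary using (yes; no; ¬_)
open import Relation.Binary.PropositionalEquality using (_≡_)

sumFin : ∀ {n} → (Fin n → ℕ) → ℕ
sumFin {zero} f = 0
sumFin {suc n} f = f zero ℕ.+ sumFin (λ j → f (suc j))

-- Only the values w x y with x ≠ y matter (pairs in binom(V,2));
-- e(G) reads each unordered pair {x,y} once, via the ordered pair x < y.
Multigraph : ℕ → Set
Multigraph n = Fin n → Fin n → ℕ

edges : ∀ n → Multigraph n → ℕ
edges zero w = 0
edges (suc n) w = sumFin (λ j → w zero (suc j)) ℕ.+ edges n (λ x y → w (suc x) (suc y))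

inPartMult : ∀ {r} (a d : ℕ) → Fin r → ℕ
inPartMult a d zero = a ∸ d
inPartMult a d (suc _) = a

partMult : ∀ {r} (a d : ℕ) → Fin r → Fin r → ℕ
partMult a d i j with i ≟ j
... | yes _ = inPartMult a d i
... | no _ = suc a

-- G ∈ T_{r,d}(a,n): there is a partition [n] = V_0 ∪ … ∪ V_{r-1}, given by
-- the part-label map c (V_i = c⁻¹(i), parts may be empty), such that every
-- pair xy (x ≠ y) has the prescribed multiplicity.
InT : (r d a n : ℕ) → Multigraph n → Set
InT r d a n w = Σ (Fin n → Fin r) λ c → ∀ x y → ¬ (x ≡ y) → w x y ≡ partMult a d (c x) (c y)

IsSigma : (r d a n S : ℕ) → Set
IsSigma r d a n S =
  (Σ (Multigraph n) λ w → InT r d a n w × edges n w ≡ S)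
  × (∀ w → InT r d a n w → edges n w ℕ.≤ S)

-- "N < x_{r⋆}(a,d) · s"  for N ∈ ℤ, s ∈ ℕ, where
-- x_{r⋆}(a,d) = log((a+1)/a) / log((a+1)^r / (a (a-d)^{r-1})).
-- Since agda-stdlib has no reals/logarithms, this is the exact arithmetic
-- rendering, valid whenever a ≥ 1, d < a, r ≥ 2 (so both logs are positive
-- and x_{r⋆} > 0):
--   * N < 0, or
--   * N = 0 and s > 0, or
--   * N = k > 0 and k·log(A/B) < s·log((a+1)/a), i.e. A^k a^s < (a+1)^s B^k,
--     where A = (a+1)^r, B = a (a-d)^{r-1}.
LtXstarTimes : (r a d : ℕ) → ℤ → ℕ → Set
LtXstarTimes r a d N s =
  N ℤ.< + 0
  ⊎ (N ≡ + 0 × 0 ℕ.< s)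
  ⊎ Σ ℕ λ k → N ≡ + suc k
      × (((suc a) ^ r) ^ suc k * a ^ s ℕ.< (suc a) ^ s * (a * (a ∸ d) ^ (r ∸ 1)) ^ suc k)

-- Take G extremal in T_{r,d}(a,s+1) and put R = r − 1. Deleting a vertex v leaves a member
-- of T_{r,d}(a,s), and v has degree (a+1)s − m_v·δ_v, where m_v counts the other vertices of
-- its part and δ_v is d + 1 on V_0 and 1 elsewhere; so Σ(a,s+1) + m_v·δ_v ≤ Σ(a,s) + (a+1)s.
-- If N = R(Σ(a,s+1) − Σ(a,s) − 1 − as) − (R−1)s is a positive integer t, this becomes
-- R(1 + m_v·δ_v) + t ≤ s for all v. Hence each V_i with i ≥ 1 has at most (s − t)/R vertices,
-- V_0 has more than t, and s ≥ R(1 + t(d+1)) + t.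
-- The claim N < x_{r⋆}·s means (a+1)^{rt} a^s < (a+1)^s (a(a−d)^R)^t. Up to common factors,
-- its case s = R(1 + t(d+1)) + t is the R-th power of a·V^t < (a+1)·U^t, where V = a^{d+2}
-- and U = a(a+1)^d(a−d), and larger s only help. Bernoulli's inequality gives V ≤ U + d²a^d,
-- and V^t ≤ U^t + t(V − U)V^{t−1} then yields a·V^t < (a+1)·U^t once (a+1)·t·d² < a², which
-- holds for a ≥ 1 + 2sd².

{-# OPTIONS --safe #-}
module Submission where

open import Defs
open import Data.Nat using (ℕ; suc; _+_; _*_; _∸_; _≤_; _<_)
open import Data.Integer as ℤ using (+_)
open import Data.Product using (Σ)

open import Data.Nat using (zero; NonZero; _^_; z≤n; s≤s; z<s; s≤s⁻¹; >-nonZero; >-nonZero⁻¹)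
open import Data.Nat.Properties
open import Data.Nat.Tactic.RingSolver using (solve-∀)
import Data.Integer.Properties as ℤ
import Data.Integer.Tactic.RingSolver as ℤ-Solver
open import Data.Fin.Base using (Fin; zero; suc; punchIn)
import Data.Fin.Properties as Fin
open import Data.Vec.Functional using (removeAt)
open import Algebra.Properties.Semiring.Sum +-*-semiring
  using (sum; sum-remove; sum-cong-≗; ∑-comm; ∑-distrib-+; *-distribˡ-sum; *-distribʳ-sum; sum-replicate-zero)
open import Data.Product using (∃; _,_)
open import Data.Sum using (_⊎_; inj₁; inj₂)
open import Function.Base using (_∘_)
open import Relation.Binary.PropositionalEquality
open import Relation.Nullary using (yes; no; contradiction)

^-distribʳ-* : ∀ x y n → (x * y) ^ n ≡ x ^ n * y ^ n
^-distribʳ-* x y zero    = refl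
^-distribʳ-* x y (suc n) = begin
  x * y * (x * y) ^ n      ≡⟨ cong (x * y *_) (^-distribʳ-* x y n) ⟩
  x * y * (x ^ n * y ^ n)  ≡⟨ [m*n]*[o*p]≡[m*o]*[n*p] x y (x ^ n) (y ^ n) ⟩
  x * x ^ n * (y * y ^ n)  ∎
  where open ≡-Reasoning

^-comm : ∀ x m n → (x ^ m) ^ n ≡ (x ^ n) ^ m
^-comm x m n = begin
  (x ^ m) ^ n  ≡⟨ ^-*-assoc x m n ⟩
  x ^ (m * n)  ≡⟨ cong (x ^_) (*-comm m n) ⟩
  x ^ (n * m)  ≡⟨ ^-*-assoc x n m ⟨
  (x ^ n) ^ m  ∎
  where open ≡-Reasoning

x*[x^[1+d]*b*c]^t : ∀ x d t b c → x * (x ^ suc d * b * c) ^ t ≡ x ^ (1 + t * suc d) * b ^ t * c ^ t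
x*[x^[1+d]*b*c]^t x d t b c = begin
  x * (x ^ suc d * b * c) ^ t              ≡⟨ cong (x *_) (^-distribʳ-* (x ^ suc d * b) c t) ⟩
  x * ((x ^ suc d * b) ^ t * c ^ t)        ≡⟨ cong (λ u → x * (u * c ^ t)) (^-distribʳ-* (x ^ suc d) b t) ⟩
  x * ((x ^ suc d) ^ t * b ^ t * c ^ t)    ≡⟨ cong (λ u → x * (u * b ^ t * c ^ t)) (^-*-assoc x (suc d) t) ⟩
  x * (x ^ (suc d * t) * b ^ t * c ^ t)    ≡⟨ cong (λ u → x * (x ^ u * b ^ t * c ^ t)) (*-comm (suc d) t) ⟩
  x * (x ^ (t * suc d) * b ^ t * c ^ t)    ≡⟨ reassoc x (x ^ (t * suc d)) (b ^ t) (c ^ t) ⟩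
  x * x ^ (t * suc d) * b ^ t * c ^ t      ∎
  where
  open ≡-Reasoning
  reassoc : ∀ x y u v → x * (y * u * v) ≡ x * y * u * v
  reassoc = solve-∀

bernoulli : ∀ a d → a ^ d * (a + d) ≤ a * suc a ^ d
bernoulli a zero    = ≤-reflexive (base a)
  where
  base : ∀ a → 1 * (a + 0) ≡ a * 1
  base = solve-∀
bernoulli a (suc d) = begin
  a * a ^ d * (a + suc d)                ≤⟨ m≤m+n _ (a ^ d * d) ⟩
  a * a ^ d * (a + suc d) + a ^ d * d    ≡⟨ expand a (a ^ d) d ⟩
  suc a * (a ^ d * (a + d))              ≤⟨ *-monoʳ-≤ (suc a) (bernoulli a d) ⟩
  suc a * (a * suc a ^ d)                ≡⟨ swap (suc a) a (suc a ^ d) ⟩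
  a * (suc a * suc a ^ d)                ∎
  where
  open ≤-Reasoning
  expand : ∀ a X d → a * X * (a + suc d) + X * d ≡ suc a * (X * (a + d))
  expand = solve-∀
  swap : ∀ x y z → x * (y * z) ≡ y * (x * z)
  swap = solve-∀

bernoulli-gap : ∀ {a d} → d ≤ a → a ^ suc d * a ≤ suc a ^ d * (a ∸ d) * a + d * d * a ^ d
bernoulli-gap {a} {d} d≤a = begin
  a ^ suc d * a                              ≡⟨ split ⟩
  a ^ d * (a + d) * (a ∸ d) + d * d * a ^ d  ≤⟨ +-monoˡ-≤ (d * d * a ^ d) (*-monoˡ-≤ (a ∸ d) (bernoulli a d)) ⟩
  a * suc a ^ d * (a ∸ d) + d * d * a ^ d    ≡⟨ cong (_+ d * d * a ^ d) (rotate a (suc a ^ d) (a ∸ d)) ⟩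
  suc a ^ d * (a ∸ d) * a + d * d * a ^ d    ∎
  where
  open ≤-Reasoning
  square : ∀ Q d X → (Q + d) * X * (Q + d) ≡ X * (Q + d + d) * Q + d * d * X
  square = solve-∀
  split : a ^ suc d * a ≡ a ^ d * (a + d) * (a ∸ d) + d * d * a ^ d
  split = subst (λ b → b * a ^ d * b ≡ a ^ d * (b + d) * (a ∸ d) + d * d * a ^ d)
                (m∸n+n≡m d≤a) (square (a ∸ d) d (a ^ d))
  rotate : ∀ x y z → x * y * z ≡ y * z * x
  rotate = solve-∀

^-suc-mean-value : ∀ {U V W} k → V ≤ U + W → V ^ suc k ≤ U ^ suc k + suc k * W * V ^ k
^-suc-mean-value {U} {V} {W} k V≤U+W with ≤-total U V
... | inj₂ V≤U = ≤-trans (^-monoˡ-≤ (suc k) V≤U) (m≤m+n (U ^ suc k) (suc k * W * V ^ k))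
... | inj₁ U≤V = go k
  where
  go : ∀ k → V ^ suc k ≤ U ^ suc k + suc k * W * V ^ k
  go zero = begin
    V * 1              ≡⟨ *-identityʳ V ⟩
    V                  ≤⟨ V≤U+W ⟩
    U + W              ≡⟨ pad U W ⟩
    U * 1 + 1 * W * 1  ∎
    where
    open ≤-Reasoning
    pad : ∀ U W → U + W ≡ U * 1 + 1 * W * 1
    pad = solve-∀
  go (suc k) = begin
    V * V ^ suc k
      ≤⟨ *-monoʳ-≤ V (go k) ⟩
    V * (U ^ suc k + suc k * W * V ^ k)
      ≡⟨ distrib V (U ^ suc k) (suc k * W) (V ^ k) ⟩
    V * U ^ suc k + suc k * W * V ^ suc k
      ≤⟨ +-monoˡ-≤ (suc k * W * V ^ suc k) (*-monoˡ-≤ (U ^ suc k) V≤U+W) ⟩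
    (U + W) * U ^ suc k + suc k * W * V ^ suc k
      ≡⟨ cong (_+ suc k * W * V ^ suc k) (*-distribʳ-+ (U ^ suc k) U W) ⟩
    U * U ^ suc k + W * U ^ suc k + suc k * W * V ^ suc k
      ≤⟨ +-monoˡ-≤ (suc k * W * V ^ suc k) (+-monoʳ-≤ (U * U ^ suc k) WU^[1+k]≤WV^[1+k]) ⟩
    U * U ^ suc k + W * V ^ suc k + suc k * W * V ^ suc k
      ≡⟨ collect (U * U ^ suc k) W (V ^ suc k) k ⟩
    U * U ^ suc k + suc (suc k) * W * V ^ suc k
      ∎
    where
    open ≤-Reasoning
    WU^[1+k]≤WV^[1+k] : W * U ^ suc k ≤ W * V ^ suc k
    WU^[1+k]≤WV^[1+k] = *-monoʳ-≤ W (^-monoˡ-≤ (suc k) U≤V)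
    distrib : ∀ V X c Y → V * (X + c * Y) ≡ V * X + c * (V * Y)
    distrib = solve-∀
    collect : ∀ X W Y k → X + W * Y + suc k * W * Y ≡ X + suc (suc k) * W * Y
    collect = solve-∀

^-ratio-< : ∀ a {U V W} k → V ≤ U + W → suc a * (suc k * W) < V → a * V ^ suc k < suc a * U ^ suc k
^-ratio-< a {U} {V} {W} k V≤U+W big =
  +-cancelʳ-< E (a * V ^ suc k) (suc a * U ^ suc k) (begin-strict
    a * V ^ suc k + E                        <⟨ +-monoʳ-< (a * V ^ suc k) (*-monoˡ-< (V ^ k) big) ⟩
    a * V ^ suc k + V * V ^ k                ≡⟨ +-comm (a * V ^ suc k) (V ^ suc k) ⟩
    suc a * V ^ suc k                        ≤⟨ *-monoʳ-≤ (suc a) (^-suc-mean-value {U} {V} {W} k V≤U+W) ⟩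
    suc a * (U ^ suc k + suc k * W * V ^ k)  ≡⟨ distrib (suc a) (U ^ suc k) (suc k * W) (V ^ k) ⟩
    suc a * U ^ suc k + E                    ∎)
  where
  open ≤-Reasoning
  instance
    V≢0 : NonZero V
    V≢0 = >-nonZero (≤-<-trans z≤n big)
    V^k≢0 : NonZero (V ^ k)
    V^k≢0 = m^n≢0 V k
  E = suc a * (suc k * W) * V ^ k
  distrib : ∀ x X y Y → x * (X + y * Y) ≡ x * X + x * y * Y
  distrib = solve-∀

[1+a]*q<a*a : ∀ {a} q → suc (2 * q) ≤ a → suc a * q < a * a
[1+a]*q<a*a {a@(suc _)} q 1+2q≤a = begin-strict
  q + a * q              ≤⟨ +-monoˡ-≤ (a * q) (m≤n*m q a) ⟩
  a * q + a * q          <⟨ m<m+n (a * q + a * q) z<s ⟩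
  a * q + a * q + a      ≡⟨ expand a q ⟩
  a * suc (2 * q)        ≤⟨ *-monoʳ-≤ a 1+2q≤a ⟩
  a * a                  ∎
  where
  open ≤-Reasoning
  expand : ∀ a q → a * q + a * q + a ≡ a * suc (2 * q)
  expand = solve-∀

balanced-< : ∀ {a d} k → d < a → suc (2 * (suc k * (d * d))) ≤ a →
  let n = 1 + suc k * suc d in a ^ n * suc a ^ suc k < suc a ^ n * (a ∸ d) ^ suc k
-- ^-ratio-< with V = (a+1)·a^{d+2} and U = (a+1)^{d+1}(a−d)·a; cancelling a^t gives the balanced form.
balanced-< {a} {d} k d<a a-large = *-cancelʳ-< (a ^ suc k) _ _
  (subst₂ _<_ (x*[x^[1+d]*b*c]^t a d (suc k) P a) (x*[x^[1+d]*b*c]^t P d (suc k) (a ∸ d) a)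
    (^-ratio-< a k gap small-gap))
  where
  P = suc a
  instance
    a≢0 : NonZero a
    a≢0 = >-nonZero (≤-<-trans z≤n d<a)
  gap : a ^ suc d * P * a ≤ P ^ suc d * (a ∸ d) * a + d * d * a ^ d * P
  gap = begin
    a ^ suc d * P * a                           ≡⟨ swap (a ^ suc d) P a ⟩
    a ^ suc d * a * P                           ≤⟨ *-monoˡ-≤ P (bernoulli-gap (<⇒≤ d<a)) ⟩
    (P ^ d * (a ∸ d) * a + d * d * a ^ d) * P   ≡⟨ distrib P (P ^ d) (a ∸ d) a (d * d * a ^ d) ⟩
    P ^ suc d * (a ∸ d) * a + d * d * a ^ d * P ∎
    where
    open ≤-Reasoning
    swap : ∀ x y z → x * y * z ≡ x * z * y
    swap = solve-∀
    distrib : ∀ P X Q a D → (X * Q * a + D) * P ≡ P * X * Q * a + D * P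
    distrib = solve-∀
  small-gap : P * (suc k * (d * d * a ^ d * P)) < a ^ suc d * P * a
  small-gap = begin-strict
    P * (suc k * (d * d * a ^ d * P))    ≡⟨ reassoc P (suc k) (d * d) (a ^ d) P ⟩
    P * (suc k * (d * d)) * (a ^ d * P)  <⟨ *-monoˡ-< (a ^ d * P) {{a^d*P≢0}} ([1+a]*q<a*a (suc k * (d * d)) a-large) ⟩
    a * a * (a ^ d * P)                  ≡⟨ rotate a (a ^ d) P ⟩
    a ^ suc d * P * a                    ∎
    where
    open ≤-Reasoning
    reassoc : ∀ x y z X P → x * (y * (z * X * P)) ≡ x * (y * z) * (X * P)
    reassoc = solve-∀
    rotate : ∀ a X P → a * a * (X * P) ≡ a * X * P * a
    rotate = solve-∀
    a^d*P≢0 : NonZero (a ^ d * P)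
    a^d*P≢0 = m*n≢0 (a ^ d) P {{m^n≢0 a d}}

balanced-<⇒power-< : ∀ {x y z} n R t {s} → .{{NonZero x}} → .{{NonZero R}} → x ≤ y →
  R * n + t ≤ s → x ^ n * y ^ t < y ^ n * z ^ t → (y ^ suc R) ^ t * x ^ s < y ^ s * (x * z ^ R) ^ t
balanced-<⇒power-< {x} {y} {z} n R t {s} x≤y s-large balanced =
  subst (λ u → (y ^ suc R) ^ t * x ^ u < y ^ u * (x * z ^ R) ^ t) (m+[n∸m]≡n s-large) (begin-strict
    (y ^ suc R) ^ t * x ^ (R * n + t + e)  ≡⟨ lhs ⟩
    (x ^ n * y ^ t) ^ R * C * x ^ e        <⟨ *-monoˡ-< (x ^ e) {{m^n≢0 x e}} (*-monoˡ-< C (^-monoˡ-< R balanced)) ⟩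
    (y ^ n * z ^ t) ^ R * C * x ^ e        ≤⟨ *-monoʳ-≤ ((y ^ n * z ^ t) ^ R * C) (^-monoˡ-≤ e x≤y) ⟩
    (y ^ n * z ^ t) ^ R * C * y ^ e        ≡⟨ rhs ⟩
    y ^ (R * n + t + e) * (x * z ^ R) ^ t  ∎)
  where
  open ≤-Reasoning
  e = s ∸ (R * n + t)
  C = x ^ t * y ^ t
  instance
    y≢0 : NonZero y
    y≢0 = >-nonZero (<-≤-trans (>-nonZero⁻¹ x) x≤y)
    C≢0 : NonZero C
    C≢0 = m*n≢0 (x ^ t) (y ^ t) {{m^n≢0 x t}} {{m^n≢0 y t}}
  ^-split : ∀ w → w ^ (R * n + t + e) ≡ (w ^ n) ^ R * w ^ t * w ^ e
  ^-split w = begin-equality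
    w ^ (R * n + t + e)          ≡⟨ ^-distribˡ-+-* w (R * n + t) e ⟩
    w ^ (R * n + t) * w ^ e      ≡⟨ cong (_* w ^ e) (^-distribˡ-+-* w (R * n) t) ⟩
    w ^ (R * n) * w ^ t * w ^ e  ≡⟨ cong (λ u → w ^ u * w ^ t * w ^ e) (*-comm R n) ⟩
    w ^ (n * R) * w ^ t * w ^ e  ≡⟨ cong (λ u → u * w ^ t * w ^ e) (^-*-assoc w n R) ⟨
    (w ^ n) ^ R * w ^ t * w ^ e  ∎
  lhs : (y ^ suc R) ^ t * x ^ (R * n + t + e) ≡ (x ^ n * y ^ t) ^ R * C * x ^ e
  lhs = begin-equality
    (y ^ suc R) ^ t * x ^ (R * n + t + e)
      ≡⟨ cong₂ _*_ (^-comm y (suc R) t) (^-split x) ⟩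
    y ^ t * (y ^ t) ^ R * ((x ^ n) ^ R * x ^ t * x ^ e)
      ≡⟨ regroup (y ^ t) ((y ^ t) ^ R) ((x ^ n) ^ R) (x ^ t) (x ^ e) ⟩
    (x ^ n) ^ R * (y ^ t) ^ R * C * x ^ e
      ≡⟨ cong (λ u → u * C * x ^ e) (^-distribʳ-* (x ^ n) (y ^ t) R) ⟨
    (x ^ n * y ^ t) ^ R * C * x ^ e
      ∎
    where
    regroup : ∀ yt ytR xnR xt xe → yt * ytR * (xnR * xt * xe) ≡ xnR * ytR * (xt * yt) * xe
    regroup = solve-∀
  rhs : (y ^ n * z ^ t) ^ R * C * y ^ e ≡ y ^ (R * n + t + e) * (x * z ^ R) ^ t
  rhs = begin-equality
    (y ^ n * z ^ t) ^ R * C * y ^ e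
      ≡⟨ cong (λ u → u * C * y ^ e) (^-distribʳ-* (y ^ n) (z ^ t) R) ⟩
    (y ^ n) ^ R * (z ^ t) ^ R * C * y ^ e
      ≡⟨ regroup ((y ^ n) ^ R) ((z ^ t) ^ R) (x ^ t) (y ^ t) (y ^ e) ⟩
    (y ^ n) ^ R * y ^ t * y ^ e * (x ^ t * (z ^ t) ^ R)
      ≡⟨ cong₂ _*_ (^-split y) (cong (x ^ t *_) (^-comm z R t)) ⟨
    y ^ (R * n + t + e) * (x ^ t * (z ^ R) ^ t)
      ≡⟨ cong (y ^ (R * n + t + e) *_) (^-distribʳ-* x (z ^ R) t) ⟨
    y ^ (R * n + t + e) * (x * z ^ R) ^ t
      ∎
    where
    regroup : ∀ ynR ztR xt yt ye → ynR * ztR * (xt * yt) * ye ≡ ynR * yt * ye * (xt * ztR)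
    regroup = solve-∀

power-< : ∀ {a d s} R k → .{{NonZero R}} → d < a → suc (2 * (s * (d * d))) ≤ a →
  R * (1 + suc k * suc d) + suc k ≤ s → (suc a ^ suc R) ^ suc k * a ^ s < suc a ^ s * (a * (a ∸ d) ^ R) ^ suc k
power-< {a} {d} {s} R k d<a a-large s-large =
  balanced-<⇒power-< (1 + suc k * suc d) R (suc k) {{>-nonZero (≤-<-trans z≤n d<a)}} (n≤1+n a) s-large
    (balanced-< k d<a a-large′)
  where
  t≤s : suc k ≤ s
  t≤s = ≤-trans (m≤n+m (suc k) (R * (1 + suc k * suc d))) s-large
  a-large′ : suc (2 * (suc k * (d * d))) ≤ a
  a-large′ = ≤-trans (s≤s (*-monoʳ-≤ 2 (*-monoˡ-≤ (d * d) t≤s))) a-large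

sumFin≡sum : ∀ {n} (f : Fin n → ℕ) → sumFin f ≡ sum f
sumFin≡sum {zero}  f = refl
sumFin≡sum {suc n} f = cong (_+_ (f zero)) (sumFin≡sum (λ j → f (suc j)))

sum-const : ∀ n m → sum {n} (λ _ → m) ≡ n * m
sum-const zero    m = refl
sum-const (suc n) m = cong (_+_ m) (sum-const n m)

sum≤n*m : ∀ {n} (f : Fin n → ℕ) {m} → (∀ i → f i ≤ m) → sum f ≤ n * m
sum≤n*m {zero}  f f≤m = z≤n
sum≤n*m {suc n} f f≤m = +-mono-≤ (f≤m zero) (sum≤n*m (λ i → f (suc i)) (λ i → f≤m (suc i)))

sumFin-cong : ∀ {n} {f g : Fin n → ℕ} → (∀ i → f i ≡ g i) → sumFin f ≡ sumFin g
sumFin-cong {f = f} {g} f≗g = trans (sumFin≡sum f) (trans (sum-cong-≗ f≗g) (sym (sumFin≡sum g)))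

edges-cong : ∀ n {w w′ : Multigraph n} → (∀ x y → x ≢ y → w x y ≡ w′ x y) → edges n w ≡ edges n w′
edges-cong zero    w≗w′ = refl
edges-cong (suc n) w≗w′ = cong₂ _+_
  (sumFin-cong (λ j → w≗w′ zero (suc j) λ ()))
  (edges-cong n (λ x y x≢y → w≗w′ (suc x) (suc y) (x≢y ∘ Fin.suc-injective)))

degree : ∀ {n} → Multigraph (suc n) → Fin (suc n) → ℕ
degree w v = sum (removeAt (w v) v)

deleteVertex : ∀ {n} → Multigraph (suc n) → Fin (suc n) → Multigraph n
deleteVertex w v x y = w (punchIn v x) (punchIn v y)

edges-deleteVertex : ∀ n (w : Multigraph (suc n)) → (∀ x y → w x y ≡ w y x) → ∀ v →
  edges (suc n) w ≡ degree w v + edges n (deleteVertex w v)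
edges-deleteVertex n w w-sym zero =
  cong (_+ edges n (deleteVertex w zero)) (sumFin≡sum (removeAt (w zero) zero))
edges-deleteVertex (suc n) w w-sym (suc v) = begin
  sumFin row₀ + edges (suc n) w₊
    ≡⟨ cong₂ _+_ (trans (sumFin≡sum row₀) (sum-remove row₀))
                 (edges-deleteVertex n w₊ (λ x y → w-sym (suc x) (suc y)) v) ⟩
  (w zero (suc v) + rest₀) + (degree w₊ v + E)
    ≡⟨ cong (λ u → (u + rest₀) + (degree w₊ v + E)) (w-sym zero (suc v)) ⟩
  (w (suc v) zero + rest₀) + (degree w₊ v + E)
    ≡⟨ interchange (w (suc v) zero) rest₀ (degree w₊ v) E ⟩
  (w (suc v) zero + degree w₊ v) + (rest₀ + E)
    ≡⟨ cong (λ u → (w (suc v) zero + degree w₊ v) + (u + E)) (sumFin≡sum (removeAt row₀ v)) ⟨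
  degree w (suc v) + edges (suc n) (deleteVertex w (suc v))
    ∎
  where
  open ≡-Reasoning
  row₀ = λ j → w zero (suc j)
  rest₀ = sum (removeAt row₀ v)
  w₊ : Multigraph (suc n)
  w₊ x y = w (suc x) (suc y)
  E = edges n (deleteVertex w₊ v)
  interchange : ∀ a b c e → (a + b) + (c + e) ≡ (a + c) + (b + e)
  interchange = solve-∀

δ : ∀ {r} → Fin r → Fin r → ℕ
δ zero    zero    = 1
δ zero    (suc _) = 0
δ (suc _) zero    = 0
δ (suc i) (suc j) = δ i j

δ-refl : ∀ {r} (i : Fin r) → δ i i ≡ 1
δ-refl zero    = refl
δ-refl (suc i) = δ-refl i

δ-≢ : ∀ {r} {i j : Fin r} → i ≢ j → δ i j ≡ 0
δ-≢ {i = zero}  {zero}  i≢j = contradiction refl i≢j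
δ-≢ {i = zero}  {suc j} i≢j = refl
δ-≢ {i = suc i} {zero}  i≢j = refl
δ-≢ {i = suc i} {suc j} i≢j = δ-≢ (i≢j ∘ cong suc)

sum-δ : ∀ {r} (j : Fin r) → sum (λ i → δ i j) ≡ 1
sum-δ {suc r} zero    = cong suc (sum-replicate-zero r)
sum-δ         (suc j) = sum-δ j

partSize : ∀ {n r} → (Fin n → Fin r) → Fin r → ℕ
partSize c i = sum (λ x → δ i (c x))

sum-partSize : ∀ {n r} (c : Fin n → Fin r) → sum (partSize c) ≡ n
sum-partSize {n} c = begin
  sum (λ i → sum (λ x → δ i (c x)))  ≡⟨ ∑-comm (λ i x → δ i (c x)) ⟩
  sum (λ x → sum (λ i → δ i (c x)))  ≡⟨ sum-cong-≗ (λ x → sum-δ (c x)) ⟩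
  sum {n} (λ _ → 1)                  ≡⟨ sum-const n 1 ⟩
  n * 1                              ≡⟨ *-identityʳ n ⟩
  n                                  ∎
  where open ≡-Reasoning

mates : ∀ {n r} → (Fin (suc n) → Fin r) → Fin (suc n) → ℕ
mates c v = partSize (removeAt c v) (c v)

partSize≡1+mates : ∀ {n r} (c : Fin (suc n) → Fin r) v → partSize c (c v) ≡ suc (mates c v)
partSize≡1+mates c v = trans (sum-remove (λ x → δ (c v) (c x))) (cong (_+ mates c v) (δ-refl (c v)))

partSize≡0⊎∃ : ∀ {n r} (c : Fin n → Fin r) i → partSize c i ≡ 0 ⊎ ∃ λ x → c x ≡ i
partSize≡0⊎∃ {zero}  c i = inj₁ refl
partSize≡0⊎∃ {suc n} c i with c zero Fin.≟ i
... | yes c₀≡i = inj₂ (zero , c₀≡i)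
... | no  c₀≢i with partSize≡0⊎∃ (λ x → c (suc x)) i
...   | inj₁ empty      = inj₁ (cong₂ _+_ (δ-≢ (c₀≢i ∘ sym)) empty)
...   | inj₂ (x , cx≡i) = inj₂ (suc x , cx≡i)

deficit : ∀ {r} → ℕ → Fin r → ℕ
deficit d zero    = suc d
deficit d (suc _) = 1

inPartMult+deficit : ∀ {r a d} → d ≤ a → (i : Fin r) → inPartMult a d i + deficit d i ≡ suc a
inPartMult+deficit {a = a} {d} d≤a zero    = trans (+-suc (a ∸ d) d) (cong suc (m∸n+n≡m d≤a))
inPartMult+deficit {a = a}     d≤a (suc i) = +-comm a 1

partMult+deficit : ∀ {r a d} → d ≤ a → (i j : Fin r) → partMult a d i j + δ i j * deficit d i ≡ suc a
partMult+deficit {a = a} {d} d≤a i j with i Fin.≟ j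
... | yes refl rewrite δ-refl i | *-identityˡ (deficit d i) = inPartMult+deficit d≤a i
... | no  i≢j  = trans (cong (λ u → suc a + u * deficit d i) (δ-≢ i≢j)) (+-identityʳ (suc a))

typeGraph : ∀ {n r} (a d : ℕ) → (Fin n → Fin r) → Multigraph n
typeGraph a d c x y = partMult a d (c x) (c y)

typeGraph-sym : ∀ {n r} a d (c : Fin n → Fin r) x y → typeGraph a d c x y ≡ typeGraph a d c y x
typeGraph-sym a d c x y with c x Fin.≟ c y | c y Fin.≟ c x
... | yes cx≡cy | yes _   rewrite cx≡cy = refl
... | yes cx≡cy | no cy≢cx = contradiction (sym cx≡cy) cy≢cx
... | no cx≢cy  | yes cy≡cx = contradiction (sym cy≡cx) cx≢cy
... | no _      | no _     = refl

sum-partMult : ∀ {n r a d} → d ≤ a → (g : Fin n → Fin r) (i : Fin r) →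
  sum (λ j → partMult a d i (g j)) + partSize g i * deficit d i ≡ suc a * n
sum-partMult {n} {a = a} {d} d≤a g i = begin
  sum mult + partSize g i * deficit d i
    ≡⟨ cong (_+_ (sum mult)) (*-distribʳ-sum (deficit d i) (λ j → δ i (g j))) ⟩
  sum mult + sum (λ j → δ i (g j) * deficit d i)
    ≡⟨ ∑-distrib-+ mult (λ j → δ i (g j) * deficit d i) ⟨
  sum (λ j → mult j + δ i (g j) * deficit d i)
    ≡⟨ sum-cong-≗ (λ j → partMult+deficit d≤a i (g j)) ⟩
  sum {n} (λ _ → suc a)
    ≡⟨ trans (sum-const n (suc a)) (*-comm n (suc a)) ⟩
  suc a * n
    ∎
  where
  open ≡-Reasoning
  mult = λ j → partMult a d i (g j)

deletion-bound : ∀ {r d a s S₁ S₀} → d ≤ a → IsSigma r d a (suc s) S₁ → IsSigma r d a s S₀ →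
  Σ (Fin (suc s) → Fin r) λ c → ∀ v →
    S₁ + mates c v * deficit d (c v) ≤ S₀ + suc a * s
deletion-bound {r} {d} {a} {s} {S₁} {S₀} d≤a ((w , (c , w-type) , e≡S₁) , _) (_ , S₀-max) = c , bound
  where
  G = typeGraph a d c
  _-_ = deleteVertex
  bound : ∀ v → S₁ + mates c v * deficit d (c v) ≤ S₀ + suc a * s
  bound v = begin
    S₁ + m
      ≡⟨ cong (_+ m) (trans (sym e≡S₁) (edges-cong (suc s) w-type)) ⟩
    edges (suc s) G + m
      ≡⟨ cong (_+ m) (edges-deleteVertex s G (typeGraph-sym a d c) v) ⟩
    degree G v + edges s (G - v) + m
      ≡⟨ rearrange (degree G v) (edges s (G - v)) m ⟩
    edges s (G - v) + (degree G v + m)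
      ≡⟨ cong (_+_ (edges s (G - v))) (sum-partMult d≤a (removeAt c v) (c v)) ⟩
    edges s (G - v) + suc a * s
      ≤⟨ +-monoˡ-≤ (suc a * s) (S₀-max (G - v) (removeAt c v , λ _ _ _ → refl)) ⟩
    S₀ + suc a * s
      ∎
    where
    open ≤-Reasoning
    m = mates c v * deficit d (c v)
    rearrange : ∀ x y z → x + y + z ≡ y + (x + z)
    rearrange = solve-∀

part₀-large : ∀ {R s t} .{{_ : NonZero R}} (c : Fin (suc s) → Fin (suc R)) →
  (∀ i → R * partSize c (suc i) + t ≤ s) → t < partSize c zero
part₀-large {R} {s} {t} c small = +-cancelʳ-≤ s (suc t) (partSize c zero) (begin
  suc t + s                          ≡⟨ cong suc (+-comm t s) ⟩
  suc s + t                          ≡⟨ cong (_+ t) (sum-partSize c) ⟨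
  partSize c zero + others + t       ≡⟨ +-assoc (partSize c zero) others t ⟩
  partSize c zero + (others + t)     ≤⟨ +-monoʳ-≤ (partSize c zero) others+t≤s ⟩
  partSize c zero + s                ∎)
  where
  open ≤-Reasoning
  others = sum (λ i → partSize c (suc i))
  others+t≤s : others + t ≤ s
  others+t≤s = *-cancelˡ-≤ R (begin
    R * (others + t)
      ≡⟨ *-distribˡ-+ R others t ⟩
    R * others + R * t
      ≡⟨ cong₂ _+_ (*-distribˡ-sum R (λ i → partSize c (suc i))) (sym (sum-const R t)) ⟩
    sum (λ i → R * partSize c (suc i)) + sum {R} (λ _ → t)
      ≡⟨ ∑-distrib-+ (λ i → R * partSize c (suc i)) (λ _ → t) ⟨
    sum (λ i → R * partSize c (suc i) + t)
      ≤⟨ sum≤n*m (λ i → R * partSize c (suc i) + t) small ⟩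
    R * s
      ∎)

deficit≢0 : ∀ {r} d (i : Fin r) → NonZero (deficit d i)
deficit≢0 d zero    = _
deficit≢0 d (suc i) = _

vertex-bounds⇒order-bound : ∀ {R d s t} .{{_ : NonZero R}} (c : Fin (suc s) → Fin (suc R)) →
  (∀ v → R * (1 + mates c v * deficit d (c v)) + t ≤ s) → R * (1 + t * suc d) + t ≤ s
vertex-bounds⇒order-bound {R} {d} {s} {t} c vertex-bound = from-part₀ (partSize≡0⊎∃ c zero)
  where
  open ≤-Reasoning
  own-part : ∀ v → R * partSize c (c v) + t ≤ s
  own-part v = begin
    R * partSize c (c v) + t                   ≡⟨ cong (λ m → R * m + t) (partSize≡1+mates c v) ⟩
    R * suc (mates c v) + t                    ≤⟨ +-monoˡ-≤ t (*-monoʳ-≤ R (s≤s m≤m*deficit)) ⟩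
    R * (1 + mates c v * deficit d (c v)) + t  ≤⟨ vertex-bound v ⟩
    s                                          ∎
    where
    m≤m*deficit : mates c v ≤ mates c v * deficit d (c v)
    m≤m*deficit = m≤m*n (mates c v) (deficit d (c v)) {{deficit≢0 d (c v)}}
  other-parts : ∀ i → R * partSize c (suc i) + t ≤ s
  other-parts i with partSize≡0⊎∃ c (suc i)
  ... | inj₁ empty rewrite empty | *-zeroʳ R = ≤-trans (m≤n+m t _) (vertex-bound zero)
  ... | inj₂ (x , cx≡1+i) = subst (λ j → R * partSize c j + t ≤ s) cx≡1+i (own-part x)
  t<size₀ : t < partSize c zero
  t<size₀ = part₀-large c other-parts
  from-part₀ : partSize c zero ≡ 0 ⊎ ∃ (λ x → c x ≡ zero) → R * (1 + t * suc d) + t ≤ s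
  from-part₀ (inj₁ empty)      = contradiction (subst (t <_) empty t<size₀) λ ()
  from-part₀ (inj₂ (x , cx≡0)) = begin
    R * (1 + t * suc d) + t
      ≤⟨ +-monoˡ-≤ t (*-monoʳ-≤ R (+-monoʳ-≤ 1 (*-monoˡ-≤ (suc d) t≤mates))) ⟩
    R * (1 + mates c x * suc d) + t
      ≡⟨ cong (λ j → R * (1 + mates c x * deficit d j) + t) cx≡0 ⟨
    R * (1 + mates c x * deficit d (c x)) + t
      ≤⟨ vertex-bound x ⟩
    s
      ∎
    where
    t≤mates : t ≤ mates c x
    t≤mates = s≤s⁻¹ (subst (t <_) (trans (cong (partSize c) (sym cx≡0)) (partSize≡1+mates c x)) t<size₀)

-- The N of the statement, for r = R′ + 2.
excess : (R′ S₁ S₀ a s : ℕ) → ℤ.ℤ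
excess R′ S₁ S₀ a s = (+ suc R′) ℤ.* ((+ S₁) ℤ.- (+ S₀) ℤ.- + 1 ℤ.- + (a * s)) ℤ.- + (R′ * s)

excess≡+⇒ : ∀ R′ S₁ S₀ a s t → excess R′ S₁ S₀ a s ≡ + t →
  suc R′ * S₁ ≡ t + R′ * s + suc R′ * (S₀ + 1 + a * s)
excess≡+⇒ R′ S₁ S₀ a s t excess≡t = ℤ.+-injective (begin
  + (R * S₁)
    ≡⟨ ℤ.pos-* R S₁ ⟩
  + R ℤ.* + S₁
    ≡⟨ unfold (+ R) (+ S₁) (+ S₀) (+ (a * s)) (+ (R′ * s)) ⟩
  excess R′ S₁ S₀ a s ℤ.+ + (R′ * s) ℤ.+ + R ℤ.* + (S₀ + 1 + a * s)
    ≡⟨ cong (λ N → N ℤ.+ + (R′ * s) ℤ.+ + R ℤ.* + (S₀ + 1 + a * s)) excess≡t ⟩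
  + t ℤ.+ + (R′ * s) ℤ.+ + R ℤ.* + (S₀ + 1 + a * s)
    ≡⟨ cong (λ u → + t ℤ.+ + (R′ * s) ℤ.+ u) (ℤ.pos-* R (S₀ + 1 + a * s)) ⟨
  + (t + R′ * s + R * (S₀ + 1 + a * s))
    ∎)
  where
  open ≡-Reasoning
  R = suc R′
  unfold : ∀ (ρ A₁ A₀ B C : ℤ.ℤ) →
    ρ ℤ.* A₁ ≡ (ρ ℤ.* (A₁ ℤ.- A₀ ℤ.- + 1 ℤ.- B) ℤ.- C) ℤ.+ C ℤ.+ ρ ℤ.* (A₀ ℤ.+ + 1 ℤ.+ B)
  unfold = ℤ-Solver.solve-∀

excess≡+⇒vertex-bound : ∀ R′ S₁ S₀ a s t {M} → excess R′ S₁ S₀ a s ≡ + t →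
  S₁ + M ≤ S₀ + suc a * s → suc R′ * (1 + M) + t ≤ s
excess≡+⇒vertex-bound R′ S₁ S₀ a s t {M} excess≡t deletion =
  +-cancelʳ-≤ (R′ * s) _ _ (+-cancelˡ-≤ (R * (S₀ + a * s)) _ _ (begin
    R * (S₀ + a * s) + (R * (1 + M) + t + R′ * s)  ≡⟨ regroup R′ t s S₀ a M ⟩
    t + R′ * s + R * (S₀ + 1 + a * s) + R * M      ≡⟨ cong (_+ R * M) (excess≡+⇒ R′ S₁ S₀ a s t excess≡t) ⟨
    R * S₁ + R * M                                 ≡⟨ *-distribˡ-+ R S₁ M ⟨
    R * (S₁ + M)                                   ≤⟨ *-monoʳ-≤ R deletion ⟩
    R * (S₀ + suc a * s)                           ≡⟨ split R′ s S₀ a ⟩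
    R * (S₀ + a * s) + (s + R′ * s)                ∎))
  where
  open ≤-Reasoning
  R = suc R′
  regroup : ∀ R′ t s S₀ a M →
    suc R′ * (S₀ + a * s) + (suc R′ * (1 + M) + t + R′ * s) ≡ t + R′ * s + suc R′ * (S₀ + 1 + a * s) + suc R′ * M
  regroup = solve-∀
  split : ∀ R′ s S₀ a → suc R′ * (S₀ + suc a * s) ≡ suc R′ * (S₀ + a * s) + (s + R′ * s)
  split = solve-∀

positive-case⇒LtXstarTimes : ∀ {r a d s} → 0 < s → ∀ N →
  (∀ k → N ≡ + suc k → (suc a ^ r) ^ suc k * a ^ s < suc a ^ s * (a * (a ∸ d) ^ (r ∸ 1)) ^ suc k) →
  LtXstarTimes r a d N s
positive-case⇒LtXstarTimes s>0 ℤ.-[1+ _ ] _   = inj₁ ℤ.-<+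
positive-case⇒LtXstarTimes s>0 (+ zero)   _   = inj₂ (inj₁ (refl , s>0))
positive-case⇒LtXstarTimes s>0 (+ suc k)  pos = inj₂ (inj₂ (k , refl , pos k refl))

proposition5p5 : (r d s : ℕ) → 2 ≤ r → 1 ≤ d → (r ∸ 1) * (d + 1) + 2 ≤ s →
    Σ ℕ λ a₀ → (a : ℕ) → a₀ ≤ a → d < a →
      (S₁ S₀ : ℕ) → IsSigma r d a (suc s) S₁ → IsSigma r d a s S₀ →
      LtXstarTimes r a d
        ((+ (r ∸ 1)) ℤ.* ((+ S₁) ℤ.- (+ S₀) ℤ.- + 1 ℤ.- + (a * s)) ℤ.- + ((r ∸ 2) * s))
        s
proposition5p5 (suc (suc R′)) d s (s≤s (s≤s z≤n)) _ s-large =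
  suc (2 * (s * (d * d))) , λ a a-large d<a S₁ S₀ σ₁ σ₀ →
    let c , deletion = deletion-bound (<⇒≤ d<a) σ₁ σ₀ in
    positive-case⇒LtXstarTimes {r = suc (suc R′)} {d = d} s>0 (excess R′ S₁ S₀ a s) λ k excess≡ →
      power-< (suc R′) k d<a a-large (vertex-bounds⇒order-bound c λ v →
        excess≡+⇒vertex-bound R′ S₁ S₀ a s (suc k) excess≡ (deletion v))
  where
  s>0 : 0 < s
  s>0 = ≤-trans (s≤s z≤n) (≤-trans (m≤n+m 2 _) s-large)
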